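{- Let $r,s$ be positive integers and $G=\mathbb{Z}_2^r\times\mathbb{Z}_4^s$. Then \[\mathcal{G}(G)\cong K_1+\bigl(2^s(2^r-1)K_1\cup(2^s-1)(K_1+2^{r+s-1}K_2)\bigr).\]
   Context: For a finite group $G$, the power graph $\mathcal{G}(G)$ is the simple graph with vertex set $G$ in which two distinct vertices are adjacent if and only if one is a power of the other. $\mathbb{Z}_k^t$ denotes the direct product of $t$ copies of the cyclic group $\mathbb{Z}_k$. $K_t$ is the complete graph on $t$ vertices; $\Gamma\cup\Gamma'$ is the disjoint union; $k\Gamma$ is the disjoint union of $k$ copies of $\Gamma$; the join $\Gamma+\Gamma'$ of disjoint graphs is their disjoint union together with all edges joining a vertex of $\Gamma$ to a vertex of $\Gamma'$. -}

module Defs where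

open import Level using (0ℓ)
open import Data.Nat using (ℕ; zero; suc; NonZero)
import Data.Nat as ℕ
open import Data.Nat.DivMod using (_mod_)
open import Data.Fin using (Fin; toℕ)
import Data.Fin as F
open import Data.Vec using (Vec; zipWith; replicate)
open import Data.Product using (Σ; _×_; _,_; ∃)
open import Data.Sum using (_⊎_; inj₁; inj₂)
open import Data.Unit using (⊤; tt)
open import Data.Empty using (⊥)
open import Relation.Nullary using (¬_)
open import Relation.Binary.PropositionalEquality using (_≡_; _≢_)
open import Function.Bundles using (_↔_; _⇔_; Inverse)

record Graph : Set₁ where
  field
    V   : Set
    Adj : V → V → Set
open Graph public

_≅_ : Graph → Graph → Set
Γ ≅ Δ = Σ (V Γ ↔ V Δ) λ f →
  ∀ x y → Adj Γ x y ⇔ Adj Δ (Inverse.to f x) (Inverse.to f y)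

infix 4 _≅_
infixr 5 _∪ᴳ_ _+ᴳ_
infixr 7 _·ᴳ_

K : ℕ → Graph
K t = record { V = Fin t ; Adj = λ i j → i ≢ j }

_∪ᴳ_ : Graph → Graph → Graph
Γ ∪ᴳ Δ = record { V = V Γ ⊎ V Δ ; Adj = adj }
  where
  adj : V Γ ⊎ V Δ → V Γ ⊎ V Δ → Set
  adj (inj₁ x) (inj₁ y) = Adj Γ x y
  adj (inj₂ x) (inj₂ y) = Adj Δ x y
  adj _        _        = ⊥

_+ᴳ_ : Graph → Graph → Graph
Γ +ᴳ Δ = record { V = V Γ ⊎ V Δ ; Adj = adj }
  where
  adj : V Γ ⊎ V Δ → V Γ ⊎ V Δ → Set
  adj (inj₁ x) (inj₁ y) = Adj Γ x y
  adj (inj₂ x) (inj₂ y) = Adj Δ x y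
  adj _        _        = ⊤

_·ᴳ_ : ℕ → Graph → Graph
k ·ᴳ Γ = record { V = Fin k × V Γ
                ; Adj = λ { (i , x) (j , y) → i ≡ j × Adj Γ x y } }

_+ₙ_ : ∀ {n} .{{_ : NonZero n}} → Fin n → Fin n → Fin n
_+ₙ_ {n} a b = (toℕ a ℕ.+ toℕ b) mod n

G : ℕ → ℕ → Set
G r s = Vec (Fin 2) r × Vec (Fin 4) s

_⊕_ : ∀ {r s} → G r s → G r s → G r s
(a , b) ⊕ (c , d) = zipWith _+ₙ_ a c , zipWith _+ₙ_ b d

e : ∀ {r s} → G r s
e = replicate _ F.zero , replicate _ F.zero

_^ᴳ_ : ∀ {r s} → G r s → ℕ → G r s
x ^ᴳ zero  = e
x ^ᴳ suc k = x ⊕ (x ^ᴳ k)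

IsPowerOf : ∀ {r s} → G r s → G r s → Set
IsPowerOf y x = ∃ λ k → y ≡ x ^ᴳ k

PowerGraph : ℕ → ℕ → Graph
PowerGraph r s = record
  { V = G r s
  ; Adj = λ x y → x ≢ y × (IsPowerOf y x ⊎ IsPowerOf x y) }

module Submission where

-- Every x ∈ G satisfies 4x = 0, so the powers of x are exactly 0, x, 2x, 3x.
-- Write an element as (a , l + 2h) with bit vectors a ∈ ℤ₂^r and l, h ∈ ℤ₂^s;
-- then 2x = (0 , 2l) and 3x = (a , l + 2(h + l)).  Hence the elements fall
-- into four classes:
--   * the identity, adjacent to everything;
--   * l = 0, a ≠ 0: involutions that are not squares, adjacent only to 0;
--   * l = 0, a = 0, h = β ≠ 0: the involutions 2β, which are squares;
--   * l = β ≠ 0: the elements of order 4 with square 2β, paired as {x, 3x}.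
-- Splitting h along β (a complement of {0, β} in ℤ₂^s) labels the order-4
-- elements above 2β by Bits r × Bits (s-1) × Fin 2, where flipping the last
-- bit exchanges x and 3x.

open import Defs
open import Data.Nat using (ℕ; zero; suc; pred; _≤_; _*_; _∸_; _^_; _+_)
open import Data.Nat.Properties using (+-identityʳ; +-∸-assoc; +-suc; m^n>0; ^-distribˡ-+-*)
open import Data.Fin using (Fin)
open import Data.Fin.Properties using (+↔⊎; *↔×; 0↔⊥; 1↔⊤)
open import Data.Vec using (Vec; []; _∷_; replicate; zipWith; map)
open import Data.Product using (_×_; _,_; proj₁; proj₂; map₁)
open import Data.Product.Algebra using (×-comm)
open import Data.Product.Function.NonDependent.Propositional using (_×-↔_)
open import Data.Sum using (_⊎_; inj₁; inj₂)
import Data.Sum as Sum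
open import Data.Sum.Function.Propositional using (_⊎-↔_)
open import Data.Unit using (⊤; tt)
open import Data.Empty using (⊥; ⊥-elim)
open import Relation.Nullary using (¬_)
open import Relation.Binary.PropositionalEquality
open import Function.Bundles using (_↔_; _⇔_; Inverse; Equivalence; mk↔ₛ′; mk⇔)
open import Function.Properties.Inverse using (↔-refl; ↔-sym; ↔-trans)
import Function.Properties.Equivalence as ⇔

to-injective : ∀ {A B : Set} (f : A ↔ B) {x y : A} →
               Inverse.to f x ≡ Inverse.to f y → x ≡ y
to-injective f {x} {y} eq = begin
  x                 ≡⟨ sym (strictlyInverseʳ x) ⟩
  from (to x)       ≡⟨ cong from eq ⟩
  from (to y)       ≡⟨ strictlyInverseʳ y ⟩
  y                 ∎
  where open Inverse f
        open ≡-Reasoning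

≅-refl : ∀ {Γ} → Γ ≅ Γ
≅-refl = ↔-refl , λ _ _ → ⇔.refl

≅-sym : ∀ {Γ Δ} → Γ ≅ Δ → Δ ≅ Γ
≅-sym {Γ} {Δ} (f , f-adj) = ↔-sym f , λ x y → ⇔.sym
  (subst₂ (λ a b → Adj Γ (from x) (from y) ⇔ Adj Δ a b)
          (strictlyInverseˡ x) (strictlyInverseˡ y) (f-adj (from x) (from y)))
  where open Inverse f

≅-trans : ∀ {Γ Δ Θ} → Γ ≅ Δ → Δ ≅ Θ → Γ ≅ Θ
≅-trans (f , f-adj) (g , g-adj) =
  ↔-trans f g , λ x y → ⇔.trans (f-adj x y) (g-adj (Inverse.to f x) (Inverse.to f y))

+ᴳ-cong : ∀ {Γ Γ′ Δ Δ′} → Γ ≅ Γ′ → Δ ≅ Δ′ → (Γ +ᴳ Δ) ≅ (Γ′ +ᴳ Δ′)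
+ᴳ-cong (f , f-adj) (g , g-adj) = (f ⊎-↔ g) , λ
  { (inj₁ x) (inj₁ y) → f-adj x y
  ; (inj₂ x) (inj₂ y) → g-adj x y
  ; (inj₁ x) (inj₂ y) → ⇔.refl
  ; (inj₂ x) (inj₁ y) → ⇔.refl }

∪ᴳ-cong : ∀ {Γ Γ′ Δ Δ′} → Γ ≅ Γ′ → Δ ≅ Δ′ → (Γ ∪ᴳ Δ) ≅ (Γ′ ∪ᴳ Δ′)
∪ᴳ-cong (f , f-adj) (g , g-adj) = (f ⊎-↔ g) , λ
  { (inj₁ x) (inj₁ y) → f-adj x y
  ; (inj₂ x) (inj₂ y) → g-adj x y
  ; (inj₁ x) (inj₂ y) → ⇔.refl
  ; (inj₂ x) (inj₁ y) → ⇔.refl }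

point : Graph
point = record { V = ⊤ ; Adj = λ _ _ → ⊥ }

point≅K1 : point ≅ K 1
point≅K1 = ↔-sym 1↔⊤ , λ { tt tt → mk⇔ ⊥-elim (λ 0≢0 → 0≢0 refl) }

infixr 7 _⋆_
_⋆_ : Set → Graph → Graph
I ⋆ Γ = record
  { V   = I × V Γ
  ; Adj = λ { (i , x) (j , y) → i ≡ j × Adj Γ x y } }

⋆-count : ∀ {I k Γ Δ} → I ↔ Fin k → Γ ≅ Δ → (I ⋆ Γ) ≅ (k ·ᴳ Δ)
⋆-count f (g , g-adj) = (f ×-↔ g) , λ { (i , x) (j , y) → mk⇔
  (λ { (i≡j , a) → cong (Inverse.to f) i≡j , Equivalence.to (g-adj x y) a })
  (λ { (fi≡fj , a) → to-injective f fi≡fj , Equivalence.from (g-adj x y) a }) }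

pattern 0F = Fin.zero
pattern 1F = Fin.suc Fin.zero
pattern 2F = Fin.suc (Fin.suc Fin.zero)
pattern 3F = Fin.suc (Fin.suc (Fin.suc Fin.zero))

Bits : ℕ → Set
Bits = Vec (Fin 2)

0ᵇ : ∀ {n} → Bits n
0ᵇ = replicate _ 0F

_⊕ᵇ_ : ∀ {n} → Bits n → Bits n → Bits n
_⊕ᵇ_ = zipWith _+ₙ_

⊕ᵇ-identityʳ : ∀ {n} (u : Bits n) → u ⊕ᵇ 0ᵇ ≡ u
⊕ᵇ-identityʳ []       = refl
⊕ᵇ-identityʳ (0F ∷ u) = cong (0F ∷_) (⊕ᵇ-identityʳ u)
⊕ᵇ-identityʳ (1F ∷ u) = cong (1F ∷_) (⊕ᵇ-identityʳ u)

⊕ᵇ-self : ∀ {n} (u : Bits n) → u ⊕ᵇ u ≡ 0ᵇ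
⊕ᵇ-self []       = refl
⊕ᵇ-self (0F ∷ u) = cong (0F ∷_) (⊕ᵇ-self u)
⊕ᵇ-self (1F ∷ u) = cong (0F ∷_) (⊕ᵇ-self u)

⊕ᵇ-cancelʳ : ∀ {n} (u x : Bits n) → (u ⊕ᵇ x) ⊕ᵇ x ≡ u
⊕ᵇ-cancelʳ []       []       = refl
⊕ᵇ-cancelʳ (0F ∷ u) (0F ∷ x) = cong (0F ∷_) (⊕ᵇ-cancelʳ u x)
⊕ᵇ-cancelʳ (0F ∷ u) (1F ∷ x) = cong (0F ∷_) (⊕ᵇ-cancelʳ u x)
⊕ᵇ-cancelʳ (1F ∷ u) (0F ∷ x) = cong (1F ∷_) (⊕ᵇ-cancelʳ u x)
⊕ᵇ-cancelʳ (1F ∷ u) (1F ∷ x) = cong (1F ∷_) (⊕ᵇ-cancelʳ u x)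

⊕ᵇ-cancelˡ : ∀ {n} (x u : Bits n) → x ⊕ᵇ (x ⊕ᵇ u) ≡ u
⊕ᵇ-cancelˡ []       []       = refl
⊕ᵇ-cancelˡ (0F ∷ x) (0F ∷ u) = cong (0F ∷_) (⊕ᵇ-cancelˡ x u)
⊕ᵇ-cancelˡ (0F ∷ x) (1F ∷ u) = cong (1F ∷_) (⊕ᵇ-cancelˡ x u)
⊕ᵇ-cancelˡ (1F ∷ x) (0F ∷ u) = cong (0F ∷_) (⊕ᵇ-cancelˡ x u)
⊕ᵇ-cancelˡ (1F ∷ x) (1F ∷ u) = cong (1F ∷_) (⊕ᵇ-cancelˡ x u)

-- Nonzero bit vectors, described by the position of their first 1:
-- either a leading 1 followed by anything, or a leading 0 followed by a
-- nonzero vector.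
Nz : ℕ → Set
Nz zero    = ⊥
Nz (suc n) = Bits n ⊎ Nz n

pattern leading t = inj₁ t
pattern later z   = inj₂ z

vec : ∀ {n} → Nz n → Bits n
vec {suc n} (leading t) = 1F ∷ t
vec {suc n} (later z)   = 0F ∷ vec z

classify : ∀ {n} → Bits n → ⊤ ⊎ Nz n
classify []       = inj₁ tt
classify (1F ∷ t) = inj₂ (leading t)
classify (0F ∷ t) with classify t
... | inj₁ tt = inj₁ tt
... | inj₂ z  = inj₂ (later z)

unclassify : ∀ {n} → ⊤ ⊎ Nz n → Bits n
unclassify (inj₁ tt) = 0ᵇ
unclassify (inj₂ z)  = vec z

unclassify-classify : ∀ {n} (v : Bits n) → unclassify (classify v) ≡ v
unclassify-classify []       = refl
unclassify-classify (1F ∷ t) = refl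
unclassify-classify (0F ∷ t) with classify t | unclassify-classify t
... | inj₁ tt | t≡0 = cong (0F ∷_) t≡0
... | inj₂ z  | t≡z = cong (0F ∷_) t≡z

classify-0ᵇ : ∀ n → classify (0ᵇ {n}) ≡ inj₁ tt
classify-0ᵇ zero = refl
classify-0ᵇ (suc n) rewrite classify-0ᵇ n = refl

classify-vec : ∀ {n} (z : Nz n) → classify (vec z) ≡ inj₂ z
classify-vec {suc n} (leading t) = refl
classify-vec {suc n} (later z) rewrite classify-vec z = refl

-- Splitting along a nonzero vector z: ℤ₂ⁿ ≅ ℤ₂ⁿ⁻¹ × {0, z}.  The Fin 2
-- component records the coset of a fixed complement of {0, z}.
split : ∀ {n} → Nz n → Bits n → Bits (pred n) × Fin 2
split {suc n}       (leading x) (0F ∷ t) = t , 0F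
split {suc n}       (leading x) (1F ∷ t) = t ⊕ᵇ x , 1F
split {suc (suc m)} (later z)   (h ∷ t)  = map₁ (h ∷_) (split z t)

unsplit : ∀ {n} → Nz n → Bits (pred n) × Fin 2 → Bits n
unsplit {suc n}       (leading x) (u , 0F)     = 0F ∷ u
unsplit {suc n}       (leading x) (u , 1F)     = 1F ∷ (u ⊕ᵇ x)
unsplit {suc (suc m)} (later z)   (h ∷ u , b)  = h ∷ unsplit z (u , b)

unsplit-split : ∀ {n} (z : Nz n) v → unsplit z (split z v) ≡ v
unsplit-split {suc n}       (leading x) (0F ∷ t) = refl
unsplit-split {suc n}       (leading x) (1F ∷ t) = cong (1F ∷_) (⊕ᵇ-cancelʳ t x)
unsplit-split {suc (suc m)} (later z)   (h ∷ t)  = cong (h ∷_) (unsplit-split z t)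

split-unsplit : ∀ {n} (z : Nz n) p → split z (unsplit z p) ≡ p
split-unsplit {suc n}       (leading x) (u , 0F)    = refl
split-unsplit {suc n}       (leading x) (u , 1F)    = cong (_, 1F) (⊕ᵇ-cancelʳ u x)
split-unsplit {suc (suc m)} (later z)   (h ∷ u , b) = cong (map₁ (h ∷_)) (split-unsplit z (u , b))

flip : Fin 2 → Fin 2
flip 0F = 1F
flip 1F = 0F

flip-≢ : ∀ t → t ≢ flip t
flip-≢ 0F ()
flip-≢ 1F ()

≢⇒flip : ∀ {t t′} → t ≢ t′ → t′ ≡ flip t
≢⇒flip {0F} {0F} t≢t′ = ⊥-elim (t≢t′ refl)
≢⇒flip {0F} {1F} _    = refl
≢⇒flip {1F} {0F} _    = refl
≢⇒flip {1F} {1F} t≢t′ = ⊥-elim (t≢t′ refl)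

unsplit-flip : ∀ {n} (z : Nz n) u t → unsplit z (u , flip t) ≡ unsplit z (u , t) ⊕ᵇ vec z
unsplit-flip {suc n}       (leading x) u        0F = refl
unsplit-flip {suc n}       (leading x) u        1F = cong (0F ∷_) (sym (⊕ᵇ-cancelʳ u x))
unsplit-flip {suc (suc m)} (later z)   (0F ∷ u) t  = cong (0F ∷_) (unsplit-flip z u t)
unsplit-flip {suc (suc m)} (later z)   (1F ∷ u) t  = cong (1F ∷_) (unsplit-flip z u t)

Fin-cong : ∀ {m n} → m ≡ n → Fin m ↔ Fin n
Fin-cong refl = ↔-refl

cons↔ : ∀ {A : Set} {n} → Vec A (suc n) ↔ (A × Vec A n)
cons↔ = mk↔ₛ′ (λ { (x ∷ xs) → x , xs }) (λ { (x , xs) → x ∷ xs })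
              (λ _ → refl) (λ { (x ∷ xs) → refl })

bits↔ : ∀ n → Bits n ↔ Fin (2 ^ n)
bits↔ zero    = mk↔ₛ′ (λ _ → 0F) (λ _ → []) (λ { 0F → refl ; (Fin.suc ()) }) (λ { [] → refl })
bits↔ (suc n) = ↔-trans cons↔ (↔-trans (↔-refl ×-↔ bits↔ n) (↔-sym *↔×))

-- 2ⁿ⁺¹ - 1 = 2ⁿ + (2ⁿ - 1): a nonzero vector of length n + 1 has a leading
-- 1 or a nonzero tail.
2^suc∸1 : ∀ n → 2 ^ n + (2 ^ n ∸ 1) ≡ 2 ^ suc n ∸ 1
2^suc∸1 n = begin
  2 ^ n + (2 ^ n ∸ 1)    ≡⟨ sym (+-∸-assoc (2 ^ n) (m^n>0 2 n)) ⟩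
  2 ^ n + 2 ^ n ∸ 1      ≡⟨ cong (λ k → 2 ^ n + k ∸ 1) (sym (+-identityʳ (2 ^ n))) ⟩
  2 ^ suc n ∸ 1          ∎
  where open ≡-Reasoning

nonzero↔ : ∀ n → Nz n ↔ Fin (2 ^ n ∸ 1)
nonzero↔ zero    = ↔-sym 0↔⊥
nonzero↔ (suc n) =
  ↔-trans (bits↔ n ⊎-↔ nonzero↔ n) (↔-trans (↔-sym +↔⊎) (Fin-cong (2^suc∸1 n)))

-- The element l + 2h of ℤ₄ and its two bits.
pack₁ : Fin 2 → Fin 2 → Fin 4
pack₁ 0F 0F = 0F
pack₁ 1F 0F = 1F
pack₁ 0F 1F = 2F
pack₁ 1F 1F = 3F

low₁ high₁ : Fin 4 → Fin 2
low₁ 0F = 0F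
low₁ 1F = 1F
low₁ 2F = 0F
low₁ 3F = 1F
high₁ 0F = 0F
high₁ 1F = 0F
high₁ 2F = 1F
high₁ 3F = 1F

Quads : ℕ → Set
Quads = Vec (Fin 4)

_⊕ᵠ_ : ∀ {n} → Quads n → Quads n → Quads n
_⊕ᵠ_ = zipWith _+ₙ_

pack : ∀ {n} → Bits n → Bits n → Quads n
pack = zipWith pack₁

low high : ∀ {n} → Quads n → Bits n
low  = map low₁
high = map high₁

low-pack : ∀ {n} (l h : Bits n) → low (pack l h) ≡ l
low-pack []       []       = refl
low-pack (0F ∷ l) (0F ∷ h) = cong (0F ∷_) (low-pack l h)
low-pack (0F ∷ l) (1F ∷ h) = cong (0F ∷_) (low-pack l h)
low-pack (1F ∷ l) (0F ∷ h) = cong (1F ∷_) (low-pack l h)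
low-pack (1F ∷ l) (1F ∷ h) = cong (1F ∷_) (low-pack l h)

high-pack : ∀ {n} (l h : Bits n) → high (pack l h) ≡ h
high-pack []       []       = refl
high-pack (0F ∷ l) (0F ∷ h) = cong (0F ∷_) (high-pack l h)
high-pack (0F ∷ l) (1F ∷ h) = cong (1F ∷_) (high-pack l h)
high-pack (1F ∷ l) (0F ∷ h) = cong (0F ∷_) (high-pack l h)
high-pack (1F ∷ l) (1F ∷ h) = cong (1F ∷_) (high-pack l h)

pack-low-high : ∀ {n} (b : Quads n) → pack (low b) (high b) ≡ b
pack-low-high []       = refl
pack-low-high (0F ∷ b) = cong (0F ∷_) (pack-low-high b)
pack-low-high (1F ∷ b) = cong (1F ∷_) (pack-low-high b)
pack-low-high (2F ∷ b) = cong (2F ∷_) (pack-low-high b)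
pack-low-high (3F ∷ b) = cong (3F ∷_) (pack-low-high b)

pack-0ᵇ : ∀ n → pack (0ᵇ {n}) 0ᵇ ≡ replicate n 0F
pack-0ᵇ zero    = refl
pack-0ᵇ (suc n) = cong (0F ∷_) (pack-0ᵇ n)

⊕ᵠ-identityʳ : ∀ {n} (b : Quads n) → b ⊕ᵠ replicate n 0F ≡ b
⊕ᵠ-identityʳ []       = refl
⊕ᵠ-identityʳ (0F ∷ b) = cong (0F ∷_) (⊕ᵠ-identityʳ b)
⊕ᵠ-identityʳ (1F ∷ b) = cong (1F ∷_) (⊕ᵠ-identityʳ b)
⊕ᵠ-identityʳ (2F ∷ b) = cong (2F ∷_) (⊕ᵠ-identityʳ b)
⊕ᵠ-identityʳ (3F ∷ b) = cong (3F ∷_) (⊕ᵠ-identityʳ b)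

pack-double : ∀ {n} (l h : Bits n) → pack l h ⊕ᵠ pack l h ≡ pack 0ᵇ l
pack-double []       []       = refl
pack-double (0F ∷ l) (0F ∷ h) = cong (0F ∷_) (pack-double l h)
pack-double (0F ∷ l) (1F ∷ h) = cong (0F ∷_) (pack-double l h)
pack-double (1F ∷ l) (0F ∷ h) = cong (2F ∷_) (pack-double l h)
pack-double (1F ∷ l) (1F ∷ h) = cong (2F ∷_) (pack-double l h)

pack-triple : ∀ {n} (l h : Bits n) →
              pack l h ⊕ᵠ (pack l h ⊕ᵠ pack l h) ≡ pack l (h ⊕ᵇ l)
pack-triple []       []       = refl
pack-triple (0F ∷ l) (0F ∷ h) = cong (0F ∷_) (pack-triple l h)
pack-triple (0F ∷ l) (1F ∷ h) = cong (2F ∷_) (pack-triple l h)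
pack-triple (1F ∷ l) (0F ∷ h) = cong (3F ∷_) (pack-triple l h)
pack-triple (1F ∷ l) (1F ∷ h) = cong (1F ∷_) (pack-triple l h)

⊕ᵠ-fourfold : ∀ {n} (b c : Quads n) → b ⊕ᵠ (b ⊕ᵠ (b ⊕ᵠ (b ⊕ᵠ c))) ≡ c
⊕ᵠ-fourfold []       []       = refl
⊕ᵠ-fourfold (b ∷ bs) (c ∷ cs) = cong₂ _∷_ (fourfold₁ b c) (⊕ᵠ-fourfold bs cs)
  where
  fourfold₁ : ∀ (b c : Fin 4) → b +ₙ (b +ₙ (b +ₙ (b +ₙ c))) ≡ c
  fourfold₁ 0F 0F = refl
  fourfold₁ 0F 1F = refl
  fourfold₁ 0F 2F = refl
  fourfold₁ 0F 3F = refl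
  fourfold₁ 1F 0F = refl
  fourfold₁ 1F 1F = refl
  fourfold₁ 1F 2F = refl
  fourfold₁ 1F 3F = refl
  fourfold₁ 2F 0F = refl
  fourfold₁ 2F 1F = refl
  fourfold₁ 2F 2F = refl
  fourfold₁ 2F 3F = refl
  fourfold₁ 3F 0F = refl
  fourfold₁ 3F 1F = refl
  fourfold₁ 3F 2F = refl
  fourfold₁ 3F 3F = refl

Among : ∀ {A : Set} → A → A → A → A → A → Set
Among y a b c d = y ≡ a ⊎ y ≡ b ⊎ y ≡ c ⊎ y ≡ d

Among-injective : ∀ {A B : Set} (f : A → B) → (∀ {x y} → f x ≡ f y → x ≡ y) →
                  ∀ {y a b c d} → Among (f y) (f a) (f b) (f c) (f d) ⇔ Among y a b c d
Among-injective f f-inj = mk⇔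
  (λ { (inj₁ p) → inj₁ (f-inj p) ; (inj₂ (inj₁ p)) → inj₂ (inj₁ (f-inj p))
     ; (inj₂ (inj₂ (inj₁ p))) → inj₂ (inj₂ (inj₁ (f-inj p)))
     ; (inj₂ (inj₂ (inj₂ p))) → inj₂ (inj₂ (inj₂ (f-inj p))) })
  (λ { (inj₁ p) → inj₁ (cong f p) ; (inj₂ (inj₁ p)) → inj₂ (inj₁ (cong f p))
     ; (inj₂ (inj₂ (inj₁ p))) → inj₂ (inj₂ (inj₁ (cong f p)))
     ; (inj₂ (inj₂ (inj₂ p))) → inj₂ (inj₂ (inj₂ (cong f p))) })

module _ {r s : ℕ} where

  ⊕-identityʳ : ∀ (x : G r s) → x ⊕ e ≡ x
  ⊕-identityʳ (a , b) = cong₂ _,_ (⊕ᵇ-identityʳ a) (⊕ᵠ-identityʳ b)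

  ⊕-fourfold : ∀ (x z : G r s) → x ⊕ (x ⊕ (x ⊕ (x ⊕ z))) ≡ z
  ⊕-fourfold (a , b) (c , d) =
    cong₂ _,_ (trans (⊕ᵇ-cancelˡ a _) (⊕ᵇ-cancelˡ a c)) (⊕ᵠ-fourfold b d)

  powers-in-G : ∀ (x y : G r s) → IsPowerOf y x ⇔ Among y e x (x ⊕ x) (x ⊕ (x ⊕ x))
  powers-in-G x y = mk⇔ (λ { (k , refl) → power k }) λ
    { (inj₁ y≡e)               → 0 , y≡e
    ; (inj₂ (inj₁ y≡x))        → 1 , trans y≡x (sym (⊕-identityʳ x))
    ; (inj₂ (inj₂ (inj₁ y≡2x))) → 2 , trans y≡2x (cong (x ⊕_) (sym (⊕-identityʳ x)))
    ; (inj₂ (inj₂ (inj₂ y≡3x))) → 3 , trans y≡3x (cong (λ z → x ⊕ (x ⊕ z)) (sym (⊕-identityʳ x))) }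
    where
    power : ∀ k → Among (x ^ᴳ k) e x (x ⊕ x) (x ⊕ (x ⊕ x))
    power 0 = inj₁ refl
    power 1 = inj₂ (inj₁ (⊕-identityʳ x))
    power 2 = inj₂ (inj₂ (inj₁ (cong (x ⊕_) (⊕-identityʳ x))))
    power 3 = inj₂ (inj₂ (inj₂ (cong (λ z → x ⊕ (x ⊕ z)) (⊕-identityʳ x))))
    power (suc (suc (suc (suc k)))) rewrite ⊕-fourfold x (x ^ᴳ k) = power k

-- Vertices: the neutral element, the involutions (α , 2w) with α ≠ 0, and for
-- each β ≠ 0 the square involution 2β together with the order-4 elements
-- (a , β + 2h) above it, paired in K₂'s.
Model : ℕ → ℕ → Graph
Model r s =
  point +ᴳ (((Nz r × Bits s) ⋆ point)
            ∪ᴳ (Nz s ⋆ (point +ᴳ ((Bits r × Bits (pred s)) ⋆ K 2))))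

pattern neutral          = inj₁ tt
pattern nonsquare α w    = inj₂ (inj₁ ((α , w) , tt))
pattern square β         = inj₂ (inj₂ (β , inj₁ tt))
pattern order4 β a u t   = inj₂ (inj₂ (β , inj₂ ((a , u) , t)))

module _ (r s : ℕ) where

  Vertex : Set
  Vertex = V (Model r s)

  ψ : Vertex → G r s
  ψ neutral          = e
  ψ (nonsquare α w)  = vec α , pack 0ᵇ w
  ψ (square β)       = 0ᵇ , pack 0ᵇ (vec β)
  ψ (order4 β a u t) = a , pack (vec β) (unsplit β (u , t))

  squareAt : ⊤ ⊎ Nz s → Vertex
  squareAt (inj₁ tt) = neutral
  squareAt (inj₂ β)  = square β

  involutionAt : ⊤ ⊎ Nz r → Bits s → Vertex
  involutionAt (inj₁ tt) h = squareAt (classify h)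
  involutionAt (inj₂ α)  h = nonsquare α h

  vertexAt : Bits r → ⊤ ⊎ Nz s → Bits s → Vertex
  vertexAt a (inj₁ tt) h = involutionAt (classify a) h
  vertexAt a (inj₂ β)  h = order4 β a (proj₁ (split β h)) (proj₂ (split β h))

  φ : G r s → Vertex
  φ (a , b) = vertexAt a (classify (low b)) (high b)

  ψ-squareAt : ∀ c → ψ (squareAt c) ≡ (0ᵇ , pack 0ᵇ (unclassify c))
  ψ-squareAt (inj₁ tt) = cong (0ᵇ ,_) (sym (pack-0ᵇ s))
  ψ-squareAt (inj₂ β)  = refl

  ψ-involutionAt : ∀ c h → ψ (involutionAt c h) ≡ (unclassify c , pack 0ᵇ h)
  ψ-involutionAt (inj₁ tt) h =
    trans (ψ-squareAt (classify h)) (cong (λ v → 0ᵇ , pack 0ᵇ v) (unclassify-classify h))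
  ψ-involutionAt (inj₂ α)  h = refl

  ψ-vertexAt : ∀ a c h → ψ (vertexAt a c h) ≡ (a , pack (unclassify c) h)
  ψ-vertexAt a (inj₁ tt) h =
    trans (ψ-involutionAt (classify a) h) (cong (λ v → v , pack 0ᵇ h) (unclassify-classify a))
  ψ-vertexAt a (inj₂ β)  h = cong (λ v → a , pack (vec β) v) (unsplit-split β h)

  ψ-φ : ∀ x → ψ (φ x) ≡ x
  ψ-φ (a , b) = trans (ψ-vertexAt a (classify (low b)) (high b))
    (cong (a ,_) (trans (cong (λ l → pack l (high b)) (unclassify-classify (low b)))
                        (pack-low-high b)))

  φ-pack : ∀ a l h → φ (a , pack l h) ≡ vertexAt a (classify l) h
  φ-pack a l h rewrite low-pack l h | high-pack l h = refl

  φ-ψ : ∀ u → φ (ψ u) ≡ u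
  φ-ψ neutral rewrite sym (pack-0ᵇ s) | φ-pack 0ᵇ 0ᵇ 0ᵇ
    | classify-0ᵇ s | classify-0ᵇ r | classify-0ᵇ s = refl
  φ-ψ (nonsquare α w) rewrite φ-pack (vec α) 0ᵇ w | classify-0ᵇ s | classify-vec α = refl
  φ-ψ (square β) rewrite φ-pack 0ᵇ 0ᵇ (vec β)
    | classify-0ᵇ s | classify-0ᵇ r | classify-vec β = refl
  φ-ψ (order4 β a u t) rewrite φ-pack a (vec β) (unsplit β (u , t))
    | classify-vec β | split-unsplit β (u , t) = refl

  ψ↔ : Vertex ↔ G r s
  ψ↔ = mk↔ₛ′ ψ φ ψ-φ φ-ψ

  ψ-injective : ∀ {u v} → ψ u ≡ ψ v → u ≡ v
  ψ-injective = to-injective ψ↔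

  twice : Vertex → Vertex
  twice (order4 β _ _ _) = square β
  twice _                = neutral

  thrice : Vertex → Vertex
  thrice (order4 β a u t) = order4 β a u (flip t)
  thrice u                = u

  ψ-twice : ∀ u → ψ u ⊕ ψ u ≡ ψ (twice u)
  ψ-twice neutral          = cong₂ _,_ (⊕ᵇ-self 0ᵇ) (⊕ᵠ-identityʳ _)
  ψ-twice (nonsquare α w)  = cong₂ _,_ (⊕ᵇ-self (vec α)) (trans (pack-double 0ᵇ w) (pack-0ᵇ s))
  ψ-twice (square β)       = cong₂ _,_ (⊕ᵇ-self 0ᵇ) (trans (pack-double 0ᵇ (vec β)) (pack-0ᵇ s))
  ψ-twice (order4 β a u t) = cong₂ _,_ (⊕ᵇ-self a) (pack-double (vec β) _)

  ψ-thrice : ∀ u → ψ u ⊕ (ψ u ⊕ ψ u) ≡ ψ (thrice u)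
  ψ-thrice neutral = cong₂ _,_ (⊕ᵇ-cancelˡ 0ᵇ 0ᵇ)
    (trans (cong (replicate s 0F ⊕ᵠ_) (⊕ᵠ-identityʳ _)) (⊕ᵠ-identityʳ _))
  ψ-thrice (nonsquare α w) = cong₂ _,_ (⊕ᵇ-cancelˡ (vec α) (vec α))
    (trans (pack-triple 0ᵇ w) (cong (pack 0ᵇ) (⊕ᵇ-identityʳ w)))
  ψ-thrice (square β) = cong₂ _,_ (⊕ᵇ-cancelˡ 0ᵇ 0ᵇ)
    (trans (pack-triple 0ᵇ (vec β)) (cong (pack 0ᵇ) (⊕ᵇ-identityʳ (vec β))))
  ψ-thrice (order4 β a u t) = cong₂ _,_ (⊕ᵇ-cancelˡ a a)
    (trans (pack-triple (vec β) _) (cong (pack (vec β)) (sym (unsplit-flip β u t))))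

  Powers : Vertex → Vertex → Set
  Powers u v = Among v neutral u (twice u) (thrice u)

  powerOf⇔Powers : ∀ u v → IsPowerOf (ψ v) (ψ u) ⇔ Powers u v
  powerOf⇔Powers u v = ⇔.trans (powers-in-G (ψ u) (ψ v)) transport
    where
    transport : Among (ψ v) e (ψ u) (ψ u ⊕ ψ u) (ψ u ⊕ (ψ u ⊕ ψ u)) ⇔ Powers u v
    transport rewrite ψ-thrice u | ψ-twice u = Among-injective ψ ψ-injective

  -- Adjacency in the model: the neutral vertex is joined to everything, and
  -- an order-4 vertex to its square and to its partner in its K₂.
  Adjacent : Vertex → Vertex → Set
  Adjacent = Adj (Model r s)

  model-irreflexive : ∀ u → ¬ Adjacent u u
  model-irreflexive neutral          ()
  model-irreflexive (nonsquare α w)  (_ , ())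
  model-irreflexive (square β)       (_ , ())
  model-irreflexive (order4 β a u t) (_ , _ , t≢t) = t≢t refl

  powers⇒adjacent : ∀ u v → u ≢ v → Powers u v → Adjacent u v × Adjacent v u
  powers⇒adjacent neutral _ u≢v (inj₁ refl) = ⊥-elim (u≢v refl)
  powers⇒adjacent (inj₂ _) _ _ (inj₁ refl) = tt , tt
  powers⇒adjacent u _ u≢v (inj₂ (inj₁ refl)) = ⊥-elim (u≢v refl)
  powers⇒adjacent neutral          _ u≢v (inj₂ (inj₂ (inj₁ refl))) = ⊥-elim (u≢v refl)
  powers⇒adjacent (nonsquare α w)  _ _   (inj₂ (inj₂ (inj₁ refl))) = tt , tt
  powers⇒adjacent (square β)       _ _   (inj₂ (inj₂ (inj₁ refl))) = tt , tt
  powers⇒adjacent (order4 β a u t) _ _   (inj₂ (inj₂ (inj₁ refl))) = (refl , tt) , (refl , tt)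
  powers⇒adjacent neutral          _ u≢v (inj₂ (inj₂ (inj₂ refl))) = ⊥-elim (u≢v refl)
  powers⇒adjacent (nonsquare α w)  _ u≢v (inj₂ (inj₂ (inj₂ refl))) = ⊥-elim (u≢v refl)
  powers⇒adjacent (square β)       _ u≢v (inj₂ (inj₂ (inj₂ refl))) = ⊥-elim (u≢v refl)
  powers⇒adjacent (order4 β a u t) _ _   (inj₂ (inj₂ (inj₂ refl))) =
    (refl , refl , flip-≢ t) , (refl , refl , λ flip-t≡t → flip-≢ t (sym flip-t≡t))

  adjacent⇒powers : ∀ u v → Adjacent u v → Powers u v ⊎ Powers v u
  adjacent⇒powers neutral  (inj₂ _) _ = inj₂ (inj₁ refl)
  adjacent⇒powers (inj₂ _) neutral  _ = inj₁ (inj₁ refl)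
  adjacent⇒powers (square β) (order4 β′ a u t) (refl , tt) = inj₂ (inj₂ (inj₂ (inj₁ refl)))
  adjacent⇒powers (order4 β a u t) (square β′) (refl , tt) = inj₁ (inj₂ (inj₂ (inj₁ refl)))
  adjacent⇒powers (order4 β a u t) (order4 β′ a′ u′ t′) (refl , refl , t≢t′) =
    inj₁ (inj₂ (inj₂ (inj₂ (cong (λ t″ → order4 β a u t″) (≢⇒flip t≢t′)))))
  adjacent⇒powers neutral           neutral           ()
  adjacent⇒powers (nonsquare _ _)   (nonsquare _ _)   (_ , ())
  adjacent⇒powers (nonsquare _ _)   (square _)        ()
  adjacent⇒powers (nonsquare _ _)   (order4 _ _ _ _)  ()
  adjacent⇒powers (square _)        (nonsquare _ _)   ()
  adjacent⇒powers (order4 _ _ _ _)  (nonsquare _ _)   ()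
  adjacent⇒powers (square _)        (square _)        (_ , ())

  model≅powerGraph : Model r s ≅ PowerGraph r s
  model≅powerGraph = ψ↔ , λ u v → mk⇔ (forward u v) (backward u v)
    where
    forward : ∀ u v → Adjacent u v → Adj (PowerGraph r s) (ψ u) (ψ v)
    forward u v adj =
      (λ ψu≡ψv → model-irreflexive u (subst (Adjacent u) (sym (ψ-injective ψu≡ψv)) adj)) ,
      Sum.map (Equivalence.from (powerOf⇔Powers u v)) (Equivalence.from (powerOf⇔Powers v u))
              (adjacent⇒powers u v adj)

    backward : ∀ u v → Adj (PowerGraph r s) (ψ u) (ψ v) → Adjacent u v
    backward u v (ψu≢ψv , inj₁ v-power) =
      proj₁ (powers⇒adjacent u v (λ u≡v → ψu≢ψv (cong ψ u≡v))
                             (Equivalence.to (powerOf⇔Powers u v) v-power))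
    backward u v (ψu≢ψv , inj₂ u-power) =
      proj₂ (powers⇒adjacent v u (λ v≡u → ψu≢ψv (cong ψ (sym v≡u)))
                             (Equivalence.to (powerOf⇔Powers v u) u-power))

nonsquares↔ : ∀ r s → (Nz r × Bits s) ↔ Fin (2 ^ s * (2 ^ r ∸ 1))
nonsquares↔ r s = ↔-trans (×-comm _ _) (↔-trans (bits↔ s ×-↔ nonzero↔ r) (↔-sym *↔×))

pairs↔ : ∀ r s → 1 ≤ s → (Bits r × Bits (pred s)) ↔ Fin (2 ^ (r + s ∸ 1))
pairs↔ r zero    ()
pairs↔ r (suc s) _  = ↔-trans (bits↔ r ×-↔ bits↔ s) (↔-trans (↔-sym *↔×) (Fin-cong size))
  where
  size : 2 ^ r * 2 ^ s ≡ 2 ^ (r + suc s ∸ 1)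
  size = sym (trans (cong (λ k → 2 ^ (k ∸ 1)) (+-suc r s)) (^-distribˡ-+-* 2 r s))

Target : ℕ → ℕ → Graph
Target r s = K 1 +ᴳ (((2 ^ s * (2 ^ r ∸ 1)) ·ᴳ K 1)
                     ∪ᴳ ((2 ^ s ∸ 1) ·ᴳ (K 1 +ᴳ ((2 ^ (r + s ∸ 1)) ·ᴳ K 2))))

model≅target : ∀ r s → 1 ≤ s → Model r s ≅ Target r s
model≅target r s 1≤s = +ᴳ-cong point≅K1 (∪ᴳ-cong nonsquares≅ clusters≅)
  where
  nonsquares≅ : (Nz r × Bits s) ⋆ point ≅ (2 ^ s * (2 ^ r ∸ 1)) ·ᴳ K 1
  nonsquares≅ = ⋆-count {Γ = point} {Δ = K 1} (nonsquares↔ r s) point≅K1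

  cluster≅ : point +ᴳ (Bits r × Bits (pred s)) ⋆ K 2 ≅ K 1 +ᴳ (2 ^ (r + s ∸ 1)) ·ᴳ K 2
  cluster≅ = +ᴳ-cong {Γ = point} {Γ′ = K 1} point≅K1 (⋆-count {Γ = K 2} {Δ = K 2} (pairs↔ r s 1≤s) ≅-refl)

  clusters≅ : Nz s ⋆ (point +ᴳ (Bits r × Bits (pred s)) ⋆ K 2)
              ≅ (2 ^ s ∸ 1) ·ᴳ (K 1 +ᴳ (2 ^ (r + s ∸ 1)) ·ᴳ K 2)
  clusters≅ = ⋆-count {Γ = point +ᴳ (Bits r × Bits (pred s)) ⋆ K 2}
                        {Δ = K 1 +ᴳ (2 ^ (r + s ∸ 1)) ·ᴳ K 2} (nonzero↔ s) cluster≅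

theorem3p11 : (r s : ℕ) → 1 ≤ r → 1 ≤ s →
    PowerGraph r s ≅
      (K 1 +ᴳ (((2 ^ s * (2 ^ r ∸ 1)) ·ᴳ K 1)
               ∪ᴳ ((2 ^ s ∸ 1) ·ᴳ (K 1 +ᴳ ((2 ^ (r + s ∸ 1)) ·ᴳ K 2)))))
theorem3p11 r s _ 1≤s = ≅-trans {Δ = Model r s} {Θ = Target r s} (≅-sym (model≅powerGraph r s)) (model≅target r s 1≤s)
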